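{- Let $n\ge1$ be an integer and regard $L_n^{(1)}$ as an $\Re$-module via $\sharp$. For $0\le i\le\lfloor (n-1)/2\rfloor$ put $u_i=v_{2i+1}$, and interpret $u_{ -1}$ and $u_{\lfloor (n+1)/2\rfloor}$ as $0$. Then for $0\le i\le\lfloor (n-1)/2\rfloor$, \[ Au_i=b_iu_{i-1}+a_iu_i+c_iu_{i+1},\qquad Bu_i=\theta_i^*u_i,\qquad Cu_i=-b_iu_{i-1}+a_iu_i-c_iu_{i+1}, \] where $a_i=\frac{n(n+2)-(n-4i-2)^2}{32}-\frac14$, $b_i=\frac{(n-2i)(n-2i+1)}{16}$, $c_i=\frac{(i+1)(2i+3)}{8}$, $\theta_i^*=\frac{(n-4i-2)^2}{16}-\frac14$.
   Context: $U(\mathfrak{sl}_2)$ is the $\mathbb C$-algebra generated by $E,F,H$ subject to $[H,E]=2E$, $[H,F]=-2F$, $[E,F]=H$ ($[x,y]=xy-yx$, $\mathbf i=\sqrt{ -1}$). For $n\in\mathbb N$, $L_n$ is the $U(\mathfrak{sl}_2)$-module with basis $v_0,\dots,v_n$ and $Ev_i=(n-i+1)v_{i-1}$ ($1\le i\le n$), $Ev_0=0$, $Fv_i=(i+1)v_{i+1}$ ($0\le i\le n-1$), $Fv_n=0$, $Hv_i=(n-2i)v_i$. For $n\ge1$, $L_n^{(1)}$ is the span of the $v_{2i+1}$, $0\le i\le\lfloor (n-1)/2\rfloor$ (the sum of the $H$-eigenspaces for eigenvalues $n-4i-2$). The universal Racah algebra $\Re$ is generated by $A,B,C,\Delta$ subject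 to $[A,B]=[B,C]=[C,A]=2\Delta$ and the requirement that each of $[A,\Delta]+AC-BA$, $[B,\Delta]+BA-CB$, $[C,\Delta]+CB-AC$ is central. $\sharp:\Re\to U(\mathfrak{sl}_2)$ is the algebra homomorphism with $A\mapsto \frac{(E+F-2)(E+F+2)}{16}$, $B\mapsto\frac{(H-2)(H+2)}{16}$, $C\mapsto \frac{(\mathbf iE-\mathbf iF-2)(\mathbf iE-\mathbf iF+2)}{16}$, $\Delta\mapsto\frac{(H+2)F^2-(H-2)E^2}{64}$; $\sharp(\Re)$ preserves $L_n^{(1)}$, making it an $\Re$-module. -}

module Defs where

open import Data.Nat as ℕ using (ℕ; zero; suc; _≤?_)
open import Data.Integer as ℤ using (ℤ; +_)
open import Data.Rational as ℚ using (ℚ; 0ℚ; 1ℚ)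
open import Data.Fin using (Fin; toℕ)
open import Relation.Nullary using (yes; no)
open import Relation.Binary.PropositionalEquality using (_≡_)

-- All structure constants of
-- L_n and of the images under ♯ lie in ℚ(i), so the ℂ-module L_n is
-- the base change of the ℚ(i)-module defined below; the statement
-- (equalities of vectors written in the basis v_j) is unaffected.

record ℚi : Set where
  constructor _+i_
  field
    re : ℚ
    im : ℚ
open ℚi public

infixl 6 _⊕_ _⊖_
infixl 7 _⊛_

_⊕_ : ℚi → ℚi → ℚi
(a +i b) ⊕ (c +i d) = (a ℚ.+ c) +i (b ℚ.+ d)

infix 8 ⊝_
⊝_ : ℚi → ℚi
⊝ (a +i b) = (ℚ.- a) +i (ℚ.- b)

_⊖_ : ℚi → ℚi → ℚi
x ⊖ y = x ⊕ (⊝ y)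

_⊛_ : ℚi → ℚi → ℚi
(a +i b) ⊛ (c +i d) = (a ℚ.* c ℚ.- b ℚ.* d) +i (a ℚ.* d ℚ.+ b ℚ.* c)

ofℚ : ℚ → ℚi
ofℚ q = q +i 0ℚ

ofℤ : ℤ → ℚi
ofℤ z = ofℚ (z ℚ./ 1)

𝟘 : ℚi
𝟘 = ofℚ 0ℚ

𝐢 : ℚi
𝐢 = 0ℚ +i 1ℚ

-- L_n: vectors are coefficient functions w.r.t. the basis v_0,…,v_n.

Ln : ℕ → Set
Ln n = Fin (suc n) → ℚi

Op : ℕ → Set
Op n = Ln n → Ln n

infixl 6 _+ᵥ_ _+ₒ_
infixr 7 _·ᵥ_ _·ₒ_
infixr 9 _∘ₒ_
infix 4 _≈ᵥ_

_+ᵥ_ : {n : ℕ} → Ln n → Ln n → Ln n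
(x +ᵥ y) j = x j ⊕ y j

_·ᵥ_ : {n : ℕ} → ℚi → Ln n → Ln n
(c ·ᵥ x) j = c ⊛ x j

0ᵥ : {n : ℕ} → Ln n
0ᵥ j = 𝟘

_+ₒ_ : {n : ℕ} → Op n → Op n → Op n
(S +ₒ T) x = S x +ᵥ T x

_·ₒ_ : {n : ℕ} → ℚi → Op n → Op n
(c ·ₒ T) x = c ·ᵥ T x

_∘ₒ_ : {n : ℕ} → Op n → Op n → Op n
(S ∘ₒ T) x = S (T x)

sc : {n : ℕ} → ℚi → Op n
sc c x = c ·ᵥ x

-- basis vector v_k (k : ℕ); v_k := 0 when k > n
v : (n : ℕ) → ℕ → Ln n
v n k j with toℕ j ℕ.≟ k
... | yes _ = ofℚ 1ℚ
... | no  _ = 𝟘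

-- Action of E, F, H on L_n, written in coordinates:
--   E v_i = (n-i+1) v_{i-1},  E v_0 = 0
--   F v_i = (i+1) v_{i+1},    F v_n = 0
--   H v_i = (n-2i) v_i
-- so (E x)_j = (n-j) x_{j+1} (j<n), (E x)_n = 0;
--    (F x)_j = j x_{j-1} (j ≥ 1), (F x)_0 = 0;
--    (H x)_j = (n-2j) x_j.

-- coordinate with index given as a natural number (0 outside range)
coord : {n : ℕ} → Ln n → ℕ → ℚi
coord {n} x k with suc k ℕ.≤? suc n
... | yes k<1+n = x (Data.Fin.fromℕ< k<1+n)
... | no  _     = 𝟘

Eop : (n : ℕ) → Op n
Eop n x j = ofℤ (+ n ℤ.- + toℕ j) ⊛ coord x (suc (toℕ j))

Fop : (n : ℕ) → Op n
Fop n x j with toℕ j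
... | zero  = 𝟘
... | suc k = ofℤ (+ suc k) ⊛ coord x k

Hop : (n : ℕ) → Op n
Hop n x j = ofℤ (+ n ℤ.- + (2 ℕ.* toℕ j)) ⊛ x j

q : ℤ → (d : ℕ) → .{{_ : ℕ.NonZero d}} → ℚi
q z d = ofℚ (z ℚ./ d)

♯A : (n : ℕ) → Op n
♯A n = q (+ 1) 16 ·ₒ
  (((Eop n +ₒ Fop n) +ₒ sc (ofℤ (ℤ.- + 2))) ∘ₒ ((Eop n +ₒ Fop n) +ₒ sc (ofℤ (+ 2))))

♯B : (n : ℕ) → Op n
♯B n = q (+ 1) 16 ·ₒ ((Hop n +ₒ sc (ofℤ (ℤ.- + 2))) ∘ₒ (Hop n +ₒ sc (ofℤ (+ 2))))

♯C : (n : ℕ) → Op n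
♯C n = q (+ 1) 16 ·ₒ
  (((𝐢 ·ₒ Eop n) +ₒ ((⊝ 𝐢) ·ₒ Fop n) +ₒ sc (ofℤ (ℤ.- + 2)))
   ∘ₒ ((𝐢 ·ₒ Eop n) +ₒ ((⊝ 𝐢) ·ₒ Fop n) +ₒ sc (ofℤ (+ 2))))

-- u_i = v_{2i+1}; u_{-1} = 0 and u_i = 0 once 2i+1 > n
-- (in particular u_{⌊(n+1)/2⌋} = 0).

u : (n : ℕ) → ℕ → Ln n
u n i = v n (suc (2 ℕ.* i))

uPrev : (n : ℕ) → ℕ → Ln n
uPrev n zero    = 0ᵥ
uPrev n (suc i) = u n i

a : ℕ → ℕ → ℚi
a n i = q ((+ n ℤ.* + (n ℕ.+ 2)) ℤ.- (+ n ℤ.- + (4 ℕ.* i ℕ.+ 2)) ℤ.* (+ n ℤ.- + (4 ℕ.* i ℕ.+ 2))) 32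
        ⊖ q (+ 1) 4

b : ℕ → ℕ → ℚi
b n i = q ((+ n ℤ.- + (2 ℕ.* i)) ℤ.* (+ n ℤ.- + (2 ℕ.* i) ℤ.+ + 1)) 16

c : ℕ → ℕ → ℚi
c n i = q (+ (suc i) ℤ.* + (2 ℕ.* i ℕ.+ 3)) 8

θ* : ℕ → ℕ → ℚi
θ* n i = q ((+ n ℤ.- + (4 ℕ.* i ℕ.+ 2)) ℤ.* (+ n ℤ.- + (4 ℕ.* i ℕ.+ 2))) 16 ⊖ q (+ 1) 4

_≈ᵥ_ : {n : ℕ} → Ln n → Ln n → Set
x ≈ᵥ y = ∀ j → x j ≡ y j

module Submission where

-- E + F and 𝐢E − 𝐢F are ladder operators T = αE + βF with αβ = 1, acting by
-- T v_k = α(n − k + 1) v_{k−1} + β(k + 1) v_{k+1}, and ♯A, ♯C are (T − 2)(T + 2)/16 = (T² − 4)/16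
-- for them. Applying T twice to u_i = v_{2i+1} only reaches u_{i−1}, u_i and u_{i+1}, and the
-- coefficients of (T² − 4)/16 u_i are α²(n − 2i)(n − 2i + 1)/16 = α² b_i,
-- ((n − 2i)(2i + 1) + (2i + 2)(n − 2i − 1) − 4)/16 = a_i and β²(2i + 2)(2i + 3)/16 = β² c_i,
-- where α² = β² = 1 for ♯A and −1 for ♯C. Likewise ♯B = (H² − 4)/16 is diagonal, H acting on v_k
-- by n − 2k.

open import Defs
open import Data.Nat using (ℕ; suc; _≤_; _*_)
open import Data.Product using (_×_)

open import Algebra.Bundles using (CommutativeRing)
open import Algebra.Consequences.Propositional using (comm∧idˡ⇒id; comm∧invˡ⇒inv; comm∧distrʳ⇒distr)
open import Relation.Binary.PropositionalEquality
open import Algebra.Definitions {A = ℚi} _≡_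
open import Algebra.Structures {A = ℚi} _≡_ using (IsCommutativeRing)
open import Data.Empty using (⊥-elim)
open import Data.Fin using (zero; suc; toℕ; fromℕ<)
import Data.Fin.Properties as FinP
open import Data.Integer as ℤ using (+_)
import Data.Integer.Properties as ℤP
import Data.Integer.Tactic.RingSolver as ℤ-Solver
open import Data.Maybe using (Maybe; zipWith)
open import Data.Nat as ℕ using (zero)
import Data.Nat.Properties as ℕP
import Data.Nat.Tactic.RingSolver as ℕ-Solver
open import Data.Product using (_,_)
open import Data.Rational as ℚ using (ℚ; 0ℚ; 1ℚ; toℚᵘ; fromℚᵘ)
import Data.Rational.Properties as ℚP
open import Data.Rational.Unnormalised as ℚᵘ using (ℚᵘ; mkℚᵘ)
import Data.Rational.Unnormalised.Properties as ℚᵘP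
open import Data.Sum using (inj₁; inj₂)
open import Function using (_∘_)
open import Level using (0ℓ)
open import Relation.Nullary using (yes; no)
open import Relation.Nullary.Decidable using (dec⇒maybe)
open import Tactic.RingSolver using (solve-∀)
open import Tactic.RingSolver.Core.AlmostCommutativeRing using (AlmostCommutativeRing; fromCommutativeRing)

ℚ-ring : AlmostCommutativeRing 0ℓ 0ℓ
ℚ-ring = fromCommutativeRing ℚP.+-*-commutativeRing (λ x → dec⇒maybe (0ℚ ℚP.≟ x))

𝟙 : ℚi
𝟙 = ofℚ 1ℚ

⊕-assoc : Associative _⊕_
⊕-assoc (a +i b) (c +i d) (e +i f) = cong₂ _+i_ (ℚP.+-assoc a c e) (ℚP.+-assoc b d f)

⊕-comm : Commutative _⊕_
⊕-comm (a +i b) (c +i d) = cong₂ _+i_ (ℚP.+-comm a c) (ℚP.+-comm b d)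

⊕-identityˡ : LeftIdentity 𝟘 _⊕_
⊕-identityˡ (a +i b) = cong₂ _+i_ (ℚP.+-identityˡ a) (ℚP.+-identityˡ b)

⊕-inverseˡ : LeftInverse 𝟘 ⊝_ _⊕_
⊕-inverseˡ (a +i b) = cong₂ _+i_ (ℚP.+-inverseˡ a) (ℚP.+-inverseˡ b)

⊛-assoc : Associative _⊛_
⊛-assoc (a +i b) (c +i d) (e +i f) = cong₂ _+i_ (real a b c d e f) (imag a b c d e f)
  where
  real : ∀ a b c d e f → (a ℚ.* c ℚ.- b ℚ.* d) ℚ.* e ℚ.- (a ℚ.* d ℚ.+ b ℚ.* c) ℚ.* f
                     ≡ a ℚ.* (c ℚ.* e ℚ.- d ℚ.* f) ℚ.- b ℚ.* (c ℚ.* f ℚ.+ d ℚ.* e)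
  real = solve-∀ ℚ-ring
  imag : ∀ a b c d e f → (a ℚ.* c ℚ.- b ℚ.* d) ℚ.* f ℚ.+ (a ℚ.* d ℚ.+ b ℚ.* c) ℚ.* e
                     ≡ a ℚ.* (c ℚ.* f ℚ.+ d ℚ.* e) ℚ.+ b ℚ.* (c ℚ.* e ℚ.- d ℚ.* f)
  imag = solve-∀ ℚ-ring

⊛-comm : Commutative _⊛_
⊛-comm (a +i b) (c +i d) = cong₂ _+i_ (real a b c d) (imag a b c d)
  where
  real : ∀ a b c d → a ℚ.* c ℚ.- b ℚ.* d ≡ c ℚ.* a ℚ.- d ℚ.* b
  real = solve-∀ ℚ-ring
  imag : ∀ a b c d → a ℚ.* d ℚ.+ b ℚ.* c ≡ c ℚ.* b ℚ.+ d ℚ.* a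
  imag = solve-∀ ℚ-ring

⊛-identityˡ : LeftIdentity 𝟙 _⊛_
⊛-identityˡ (a +i b) = cong₂ _+i_ (real a b) (imag a b)
  where
  real : ∀ a b → 1ℚ ℚ.* a ℚ.- 0ℚ ℚ.* b ≡ a
  real = solve-∀ ℚ-ring
  imag : ∀ a b → 1ℚ ℚ.* b ℚ.+ 0ℚ ℚ.* a ≡ b
  imag = solve-∀ ℚ-ring

⊛-distribʳ : _⊛_ DistributesOverʳ _⊕_
⊛-distribʳ (a +i b) (c +i d) (e +i f) = cong₂ _+i_ (real a b c d e f) (imag a b c d e f)
  where
  real : ∀ a b c d e f → (c ℚ.+ e) ℚ.* a ℚ.- (d ℚ.+ f) ℚ.* b
                     ≡ (c ℚ.* a ℚ.- d ℚ.* b) ℚ.+ (e ℚ.* a ℚ.- f ℚ.* b)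
  real = solve-∀ ℚ-ring
  imag : ∀ a b c d e f → (c ℚ.+ e) ℚ.* b ℚ.+ (d ℚ.+ f) ℚ.* a
                     ≡ (c ℚ.* b ℚ.+ d ℚ.* a) ℚ.+ (e ℚ.* b ℚ.+ f ℚ.* a)
  imag = solve-∀ ℚ-ring

ℚi-isCommutativeRing : IsCommutativeRing _⊕_ _⊛_ ⊝_ 𝟘 𝟙
ℚi-isCommutativeRing = record
  { isRing = record
    { +-isAbelianGroup = record
      { isGroup = record
        { isMonoid = record
          { isSemigroup = record
            { isMagma = record { isEquivalence = isEquivalence ; ∙-cong = cong₂ _⊕_ }
            ; assoc = ⊕-assoc
            }
          ; identity = comm∧idˡ⇒id ⊕-comm ⊕-identityˡ
          }
        ; inverse = comm∧invˡ⇒inv ⊕-comm ⊕-inverseˡ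
        ; ⁻¹-cong = cong ⊝_
        }
      ; comm = ⊕-comm
      }
    ; *-cong = cong₂ _⊛_
    ; *-assoc = ⊛-assoc
    ; *-identity = comm∧idˡ⇒id ⊛-comm ⊛-identityˡ
    ; distrib = comm∧distrʳ⇒distr (cong₂ _⊕_) ⊛-comm ⊛-distribʳ
    }
  ; *-comm = ⊛-comm
  }

ℚi-commutativeRing : CommutativeRing 0ℓ 0ℓ
ℚi-commutativeRing = record { isCommutativeRing = ℚi-isCommutativeRing }

module ℚ[i] = CommutativeRing ℚi-commutativeRing
open import Algebra.Properties.CommutativeSemigroup ℚ[i].+-commutativeSemigroup using (interchange)
open import Algebra.Properties.CommutativeSemigroup ℚ[i].*-commutativeSemigroup using (x∙yz≈y∙xz)
open import Algebra.Properties.Ring ℚ[i].ring using (-1*x≈-x)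

ℚi-ring : AlmostCommutativeRing 0ℓ 0ℓ
ℚi-ring = fromCommutativeRing ℚi-commutativeRing isZero
  where
  isZero : (x : ℚi) → Maybe (𝟘 ≡ x)
  isZero (a +i b) = zipWith (cong₂ _+i_) (dec⇒maybe (0ℚ ℚP.≟ a)) (dec⇒maybe (0ℚ ℚP.≟ b))

module _ {_∙_ : ℚ → ℚ → ℚ} {_∙ᵘ_ : ℚᵘ → ℚᵘ → ℚᵘ}
         (toℚᵘ-homo : ∀ p q → toℚᵘ (p ∙ q) ℚᵘ.≃ toℚᵘ p ∙ᵘ toℚᵘ q)
         (∙ᵘ-cong : ∀ {p p′ q q′} → p ℚᵘ.≃ p′ → q ℚᵘ.≃ q′ → p ∙ᵘ q ℚᵘ.≃ p′ ∙ᵘ q′)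
         where

  fromℚᵘ-homo : ∀ p q → fromℚᵘ (p ∙ᵘ q) ≡ fromℚᵘ p ∙ fromℚᵘ q
  fromℚᵘ-homo p q = ℚP.toℚᵘ-injective (begin
    toℚᵘ (fromℚᵘ (p ∙ᵘ q))               ≈⟨ ℚP.toℚᵘ-fromℚᵘ (p ∙ᵘ q) ⟩
    p ∙ᵘ q                               ≈⟨ ∙ᵘ-cong (back p) (back q) ⟩
    toℚᵘ (fromℚᵘ p) ∙ᵘ toℚᵘ (fromℚᵘ q)   ≈⟨ toℚᵘ-homo (fromℚᵘ p) (fromℚᵘ q) ⟨
    toℚᵘ (fromℚᵘ p ∙ fromℚᵘ q)           ∎)
    where
    open ℚᵘP.≃-Reasoning
    back : ∀ r → r ℚᵘ.≃ toℚᵘ (fromℚᵘ r)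
    back r = ℚᵘP.≃-sym (ℚP.toℚᵘ-fromℚᵘ r)

fromℚᵘ-homo-+ : ∀ p q → fromℚᵘ (p ℚᵘ.+ q) ≡ fromℚᵘ p ℚ.+ fromℚᵘ q
fromℚᵘ-homo-+ = fromℚᵘ-homo ℚP.toℚᵘ-homo-+ ℚᵘP.+-cong

fromℚᵘ-homo-* : ∀ p q → fromℚᵘ (p ℚᵘ.* q) ≡ fromℚᵘ p ℚ.* fromℚᵘ q
fromℚᵘ-homo-* = fromℚᵘ-homo ℚP.toℚᵘ-homo-* ℚᵘP.*-cong

fromℚᵘ-homo-neg : ∀ p → fromℚᵘ (ℚᵘ.- p) ≡ ℚ.- fromℚᵘ p
fromℚᵘ-homo-neg p = ℚP.toℚᵘ-injective (begin
  toℚᵘ (fromℚᵘ (ℚᵘ.- p))   ≈⟨ ℚP.toℚᵘ-fromℚᵘ (ℚᵘ.- p) ⟩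
  ℚᵘ.- p                   ≈⟨ ℚᵘP.-‿cong (ℚᵘP.≃-sym (ℚP.toℚᵘ-fromℚᵘ p)) ⟩
  ℚᵘ.- toℚᵘ (fromℚᵘ p)     ≈⟨ ℚP.toℚᵘ-homo‿- (fromℚᵘ p) ⟨
  toℚᵘ (ℚ.- fromℚᵘ p)      ∎)
  where open ℚᵘP.≃-Reasoning

ofℚ-homo-* : ∀ p q → ofℚ (p ℚ.* q) ≡ ofℚ p ⊛ ofℚ q
ofℚ-homo-* p q = cong₂ _+i_ (real p q) (imag p q)
  where
  real : ∀ p q → p ℚ.* q ≡ p ℚ.* q ℚ.- 0ℚ ℚ.* 0ℚ
  real = solve-∀ ℚ-ring
  imag : ∀ p q → 0ℚ ≡ p ℚ.* 0ℚ ℚ.+ 0ℚ ℚ.* q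
  imag = solve-∀ ℚ-ring

-- ofℤ z and q z (suc d) unfold to fromℚᵘ (mkℚᵘ z 0) and fromℚᵘ (mkℚᵘ z d), so the
-- homomorphism properties of fromℚᵘ transfer to them.
ofℤ-homo-+ : ∀ x y → ofℤ (x ℤ.+ y) ≡ ofℤ x ⊕ ofℤ y
ofℤ-homo-+ x y =
  cong ofℚ (trans (ℚP.fromℚᵘ-cong {mkℚᵘ (x ℤ.+ y) 0} {mkℚᵘ x 0 ℚᵘ.+ mkℚᵘ y 0}
                                  (ℚᵘ.*≡* (numerators x y)))
                 (fromℚᵘ-homo-+ (mkℚᵘ x 0) (mkℚᵘ y 0)))
  where
  numerators : ∀ x y → (x ℤ.+ y) ℤ.* + 1 ≡ (x ℤ.* + 1 ℤ.+ y ℤ.* + 1) ℤ.* + 1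
  numerators = ℤ-Solver.solve-∀

ofℤ-homo-* : ∀ x y → ofℤ (x ℤ.* y) ≡ ofℤ x ⊛ ofℤ y
ofℤ-homo-* x y =
  trans (cong ofℚ (fromℚᵘ-homo-* (mkℚᵘ x 0) (mkℚᵘ y 0))) (ofℚ-homo-* (x ℚ./ 1) (y ℚ./ 1))

ofℤ-homo-neg : ∀ x → ofℤ (ℤ.- x) ≡ ⊝ ofℤ x
ofℤ-homo-neg x = cong ofℚ (fromℚᵘ-homo-neg (mkℚᵘ x 0))

q-split : ∀ z d → q z (suc d) ≡ ofℤ z ⊛ q (+ 1) (suc d)
q-split z d = trans
  (cong ofℚ (trans (ℚP.fromℚᵘ-cong {mkℚᵘ z d} {mkℚᵘ z 0 ℚᵘ.* mkℚᵘ (+ 1) d} (ℚᵘ.*≡* cross))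
                   (fromℚᵘ-homo-* (mkℚᵘ z 0) (mkℚᵘ (+ 1) d))))
  (ofℚ-homo-* (z ℚ./ 1) (+ 1 ℚ./ suc d))
  where
  cross : z ℤ.* + suc (d ℕ.+ 0) ≡ (z ℤ.* + 1) ℤ.* + suc d
  cross = cong₂ ℤ._*_ (sym (ℤP.*-identityʳ z)) (cong (λ m → + suc m) (ℕP.+-identityʳ d))

-- ι k is k in ℚ(i); by recursion, so that ι (suc k) unfolds to ι k ⊕ 𝟙 for the ring solver.
ι : ℕ → ℚi
ι zero    = 𝟘
ι (suc k) = ι k ⊕ 𝟙

ofℤ-pos : ∀ k → ofℤ (+ k) ≡ ι k
ofℤ-pos zero    = refl
ofℤ-pos (suc k) = begin
  ofℤ (+ suc k)          ≡⟨ cong ofℤ (ℤP.pos-+ 1 k) ⟩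
  ofℤ (+ 1 ℤ.+ + k)      ≡⟨ ofℤ-homo-+ (+ 1) (+ k) ⟩
  𝟙 ⊕ ofℤ (+ k)          ≡⟨ ⊕-comm 𝟙 (ofℤ (+ k)) ⟩
  ofℤ (+ k) ⊕ 𝟙          ≡⟨ cong (_⊕ 𝟙) (ofℤ-pos k) ⟩
  ι k ⊕ 𝟙                ∎
  where open ≡-Reasoning

ofℤ-homo-sub : ∀ x y → ofℤ (x ℤ.- y) ≡ ofℤ x ⊖ ofℤ y
ofℤ-homo-sub x y = trans (ofℤ-homo-+ x (ℤ.- y)) (cong (ofℤ x ⊕_) (ofℤ-homo-neg y))

ofℤ-pos-sub : ∀ a b → ofℤ (+ a ℤ.- + b) ≡ ι a ⊖ ι b
ofℤ-pos-sub a b = trans (ofℤ-homo-sub (+ a) (+ b)) (cong₂ _⊖_ (ofℤ-pos a) (ofℤ-pos b))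

ι-homo-+ : ∀ a b → ι (a ℕ.+ b) ≡ ι a ⊕ ι b
ι-homo-+ a b = begin
  ι (a ℕ.+ b)                ≡⟨ ofℤ-pos (a ℕ.+ b) ⟨
  ofℤ (+ (a ℕ.+ b))          ≡⟨ cong ofℤ (ℤP.pos-+ a b) ⟩
  ofℤ (+ a ℤ.+ + b)          ≡⟨ ofℤ-homo-+ (+ a) (+ b) ⟩
  ofℤ (+ a) ⊕ ofℤ (+ b)      ≡⟨ cong₂ _⊕_ (ofℤ-pos a) (ofℤ-pos b) ⟩
  ι a ⊕ ι b                  ∎
  where open ≡-Reasoning

ι-homo-* : ∀ a b → ι (a ℕ.* b) ≡ ι a ⊛ ι b
ι-homo-* a b = begin
  ι (a ℕ.* b)                ≡⟨ ofℤ-pos (a ℕ.* b) ⟨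
  ofℤ (+ (a ℕ.* b))          ≡⟨ cong ofℤ (ℤP.pos-* a b) ⟩
  ofℤ (+ a ℤ.* + b)          ≡⟨ ofℤ-homo-* (+ a) (+ b) ⟩
  ofℤ (+ a) ⊛ ofℤ (+ b)      ≡⟨ cong₂ _⊛_ (ofℤ-pos a) (ofℤ-pos b) ⟩
  ι a ⊛ ι b                  ∎
  where open ≡-Reasoning

record IsLinearForm {n : ℕ} (φ : Ln n → ℚi) : Set where
  field
    preserves-≈ : ∀ {x y} → x ≈ᵥ y → φ x ≡ φ y
    additive    : ∀ x y → φ (x +ᵥ y) ≡ φ x ⊕ φ y
    homogeneous : ∀ c x → φ (c ·ᵥ x) ≡ c ⊛ φ x

  combination : ∀ c d x y → φ (c ·ᵥ x +ᵥ d ·ᵥ y) ≡ c ⊛ φ x ⊕ d ⊛ φ y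
  combination c d x y =
    trans (additive (c ·ᵥ x) (d ·ᵥ y)) (cong₂ _⊕_ (homogeneous c x) (homogeneous d y))

IsLinear : {n : ℕ} → Op n → Set
IsLinear T = ∀ j → IsLinearForm (λ x → T x j)

module _ {n : ℕ} where

  zero-form : IsLinearForm {n} (λ _ → 𝟘)
  zero-form = record
    { preserves-≈ = λ _ → refl
    ; additive    = λ _ _ → sym (ℚ[i].+-identityˡ 𝟘)
    ; homogeneous = λ c _ → sym (ℚ[i].zeroʳ c)
    }

  eval-form : ∀ j → IsLinearForm {n} (λ x → x j)
  eval-form j = record
    { preserves-≈ = λ x≈y → x≈y j
    ; additive    = λ _ _ → refl
    ; homogeneous = λ _ _ → refl
    }

  coord-form : ∀ k → IsLinearForm {n} (λ x → coord x k)
  coord-form k = record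
    { preserves-≈ = preserves-≈
    ; additive    = additive
    ; homogeneous = homogeneous
    }
    where
    preserves-≈ : {x y : Ln n} → x ≈ᵥ y → coord x k ≡ coord y k
    preserves-≈ x≈y with suc k ℕ.≤? suc n
    ... | yes k≤n = x≈y (fromℕ< k≤n)
    ... | no  _   = refl
    additive : (x y : Ln n) → coord (x +ᵥ y) k ≡ coord x k ⊕ coord y k
    additive x y with suc k ℕ.≤? suc n
    ... | yes _ = refl
    ... | no  _ = sym (ℚ[i].+-identityˡ 𝟘)
    homogeneous : ∀ c (x : Ln n) → coord (c ·ᵥ x) k ≡ c ⊛ coord x k
    homogeneous c x with suc k ℕ.≤? suc n
    ... | yes _ = refl
    ... | no  _ = sym (ℚ[i].zeroʳ c)

  scale-form : ∀ {φ} w → IsLinearForm {n} φ → IsLinearForm (λ x → w ⊛ φ x)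
  scale-form w φ-form = record
    { preserves-≈ = λ x≈y → cong (w ⊛_) (preserves-≈ x≈y)
    ; additive    = λ x y → trans (cong (w ⊛_) (additive x y)) (ℚ[i].distribˡ w _ _)
    ; homogeneous = λ c x → trans (cong (w ⊛_) (homogeneous c x)) (x∙yz≈y∙xz w c _)
    }
    where open IsLinearForm φ-form

  sum-form : ∀ {φ ψ : Ln n → ℚi} →
             IsLinearForm φ → IsLinearForm ψ → IsLinearForm (λ x → φ x ⊕ ψ x)
  sum-form {φ} {ψ} φ-form ψ-form = record
    { preserves-≈ = λ x≈y → cong₂ _⊕_ (φ.preserves-≈ x≈y) (ψ.preserves-≈ x≈y)
    ; additive    = λ x y → trans (cong₂ _⊕_ (φ.additive x y) (ψ.additive x y))
                                  (interchange (φ x) (φ y) (ψ x) (ψ y))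
    ; homogeneous = λ c x → trans (cong₂ _⊕_ (φ.homogeneous c x) (ψ.homogeneous c x))
                                  (sym (ℚ[i].distribˡ c (φ x) (ψ x)))
    }
    where
    module φ = IsLinearForm φ-form
    module ψ = IsLinearForm ψ-form

  +ₒ-linear : ∀ {S T : Op n} → IsLinear S → IsLinear T → IsLinear (S +ₒ T)
  +ₒ-linear S-linear T-linear j = sum-form (S-linear j) (T-linear j)

  ·ₒ-linear : ∀ {T : Op n} c → IsLinear T → IsLinear (c ·ₒ T)
  ·ₒ-linear c T-linear j = scale-form c (T-linear j)

  Eop-linear : IsLinear (Eop n)
  Eop-linear j = scale-form (ofℤ (+ n ℤ.- + toℕ j)) (coord-form (suc (toℕ j)))

  Fop-linear : IsLinear (Fop n)
  Fop-linear zero    = zero-form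
  Fop-linear (suc j) = scale-form (ofℤ (+ suc (toℕ j))) (coord-form (toℕ j))

  Hop-linear : IsLinear (Hop n)
  Hop-linear j = scale-form (ofℤ (+ n ℤ.- + (2 * toℕ j))) (eval-form j)

δ : ℕ → ℕ → ℚi
δ zero    zero    = 𝟙
δ zero    (suc _) = 𝟘
δ (suc _) zero    = 𝟘
δ (suc m) (suc k) = δ m k

δ-diag : ∀ m → δ m m ≡ 𝟙
δ-diag zero    = refl
δ-diag (suc m) = δ-diag m

δ-offdiag : ∀ {m k} → k ≢ m → δ m k ≡ 𝟘
δ-offdiag {zero}  {zero}  0≢0   = ⊥-elim (0≢0 refl)
δ-offdiag {zero}  {suc k} _     = refl
δ-offdiag {suc m} {zero}  _     = refl
δ-offdiag {suc m} {suc k} sk≢sm = δ-offdiag (sk≢sm ∘ cong suc)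

δ-transfer : ∀ (f : ℕ → ℚi) m k → f k ⊛ δ m k ≡ f m ⊛ δ m k
δ-transfer f m k with k ℕ.≟ m
... | yes refl = refl
... | no  k≢m  = begin
  f k ⊛ δ m k   ≡⟨ cong (f k ⊛_) (δ-offdiag k≢m) ⟩
  f k ⊛ 𝟘       ≡⟨ ℚ[i].zeroʳ (f k) ⟩
  𝟘             ≡⟨ ℚ[i].zeroʳ (f m) ⟨
  f m ⊛ 𝟘       ≡⟨ cong (f m ⊛_) (δ-offdiag k≢m) ⟨
  f m ⊛ δ m k   ∎
  where open ≡-Reasoning

v-δ : ∀ n m j → v n m j ≡ δ m (toℕ j)
v-δ n m j with toℕ j ℕ.≟ m
... | yes refl = sym (δ-diag (toℕ j))
... | no  j≢m  = sym (δ-offdiag j≢m)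

coord-v : ∀ n m k → k ≤ n → coord (v n m) k ≡ δ m k
coord-v n m k k≤n with suc k ℕ.≤? suc n
... | yes k<1+n = trans (v-δ n m (fromℕ< k<1+n)) (cong (δ m) (FinP.toℕ-fromℕ< k<1+n))
... | no  k≮1+n = ⊥-elim (k≮1+n (ℕ.s≤s k≤n))

weight : ℕ → ℕ → ℚi
weight n k = ι n ⊖ ι 2 ⊛ ι k

vPrev : (n : ℕ) → ℕ → Ln n
vPrev n zero    = 0ᵥ
vPrev n (suc k) = v n k

module _ (n : ℕ) where

  private
    δ-transfer-v : ∀ (f : ℕ → ℚi) k j → f (toℕ j) ⊛ δ k (toℕ j) ≡ f k ⊛ v n k j
    δ-transfer-v f k j = trans (δ-transfer f k (toℕ j)) (cong (f k ⊛_) (sym (v-δ n k j)))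

    cancelled-coefficient : ∀ x a b → (x ⊖ x) ⊛ a ≡ (x ⊖ x) ⊛ b
    cancelled-coefficient x a b = begin
      (x ⊖ x) ⊛ a  ≡⟨ cong (_⊛ a) (ℚ[i].-‿inverseʳ x) ⟩
      𝟘 ⊛ a        ≡⟨ ℚ[i].zeroˡ a ⟩
      𝟘            ≡⟨ ℚ[i].zeroˡ b ⟨
      𝟘 ⊛ b        ≡⟨ cong (_⊛ b) (ℚ[i].-‿inverseʳ x) ⟨
      (x ⊖ x) ⊛ b  ∎
      where open ≡-Reasoning

    -- At the last coordinate t = n the coefficient n − t vanishes, so coordinate n + 1,
    -- which lies outside L_n, never contributes.
    E-coord-v : ∀ m t → t ≤ n → (ι n ⊖ ι t) ⊛ coord (v n m) (suc t) ≡ (ι n ⊖ ι t) ⊛ δ m (suc t)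
    E-coord-v m t t≤n with ℕP.m≤n⇒m<n∨m≡n t≤n
    ... | inj₁ t<n  = cong ((ι n ⊖ ι t) ⊛_) (coord-v n m (suc t) t<n)
    ... | inj₂ refl = cancelled-coefficient (ι t) _ _

    shift-down : ∀ x y → x ⊖ y ≡ x ⊖ (y ⊕ 𝟙) ⊕ 𝟙
    shift-down = solve-∀ ℚi-ring

  E-v : ∀ k → Eop n (v n k) ≈ᵥ (ι n ⊖ ι k ⊕ 𝟙) ·ᵥ vPrev n k
  E-v k j = begin
    ofℤ (+ n ℤ.- + t) ⊛ coord (v n k) (suc t)   ≡⟨ cong (_⊛ coord (v n k) (suc t)) (ofℤ-pos-sub n t) ⟩
    (ι n ⊖ ι t) ⊛ coord (v n k) (suc t)          ≡⟨ E-coord-v k t (FinP.toℕ≤pred[n] j) ⟩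
    (ι n ⊖ ι t) ⊛ δ k (suc t)                    ≡⟨ lower k ⟩
    (ι n ⊖ ι k ⊕ 𝟙) ⊛ vPrev n k j                ∎
    where
    open ≡-Reasoning
    t = toℕ j
    lower : ∀ k → (ι n ⊖ ι t) ⊛ δ k (suc t) ≡ (ι n ⊖ ι k ⊕ 𝟙) ⊛ vPrev n k j
    lower zero    = trans (ℚ[i].zeroʳ (ι n ⊖ ι t)) (sym (ℚ[i].zeroʳ (ι n ⊖ ι 0 ⊕ 𝟙)))
    lower (suc k) = trans (δ-transfer-v (λ s → ι n ⊖ ι s) k j)
                          (cong (_⊛ v n k j) (shift-down (ι n) (ι k)))

  F-v : ∀ k → Fop n (v n k) ≈ᵥ (ι k ⊕ 𝟙) ·ᵥ v n (suc k)
  F-v k zero    = begin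
    𝟘                             ≡⟨ ℚ[i].zeroʳ (ι k ⊕ 𝟙) ⟨
    (ι k ⊕ 𝟙) ⊛ δ (suc k) 0       ≡⟨ cong ((ι k ⊕ 𝟙) ⊛_) (v-δ n (suc k) zero) ⟨
    (ι k ⊕ 𝟙) ⊛ v n (suc k) zero  ∎
    where open ≡-Reasoning
  F-v k (suc j) = begin
    ofℤ (+ suc t) ⊛ coord (v n k) t  ≡⟨ cong₂ _⊛_ (ofℤ-pos (suc t)) (coord-v n k t (FinP.toℕ≤n j)) ⟩
    (ι t ⊕ 𝟙) ⊛ δ k t                ≡⟨ δ-transfer (λ s → ι s ⊕ 𝟙) k t ⟩
    (ι k ⊕ 𝟙) ⊛ δ k t                ≡⟨ cong ((ι k ⊕ 𝟙) ⊛_) (v-δ n (suc k) (suc j)) ⟨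
    (ι k ⊕ 𝟙) ⊛ v n (suc k) (suc j)  ∎
    where
    open ≡-Reasoning
    t = toℕ j

  H-v : ∀ k → Hop n (v n k) ≈ᵥ weight n k ·ᵥ v n k
  H-v k j = begin
    ofℤ (+ n ℤ.- + (2 * t)) ⊛ v n k j   ≡⟨ cong₂ _⊛_ coefficient (v-δ n k j) ⟩
    (ι n ⊖ ι 2 ⊛ ι t) ⊛ δ k t           ≡⟨ δ-transfer-v (λ s → ι n ⊖ ι 2 ⊛ ι s) k j ⟩
    weight n k ⊛ v n k j                ∎
    where
    open ≡-Reasoning
    t = toℕ j
    coefficient : ofℤ (+ n ℤ.- + (2 * t)) ≡ ι n ⊖ ι 2 ⊛ ι t
    coefficient = trans (ofℤ-pos-sub n (2 * t)) (cong (λ x → ι n ⊖ x) (ι-homo-* 2 t))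

sixteenth : ℚi
sixteenth = q (+ 1) 16

-- ♯A, ♯B and ♯C are by definition shiftedSquare of E + F, H and Ladder n 𝐢 (⊝ 𝐢).
shiftedSquare : {n : ℕ} → Op n → Op n
shiftedSquare T = sixteenth ·ₒ ((T +ₒ sc (ofℤ (ℤ.- + 2))) ∘ₒ (T +ₒ sc (ofℤ (+ 2))))

shiftedSquare-apply : ∀ {n} {T : Op n} → IsLinear T →
  ∀ x j → shiftedSquare T x j ≡ sixteenth ⊛ (T (T x) j ⊖ ι 4 ⊛ x j)
shiftedSquare-apply {T = T} T-linear x j = begin
  sixteenth ⊛ (T (T x +ᵥ p2 ·ᵥ x) j ⊕ m2 ⊛ (T x j ⊕ p2 ⊛ x j))
    ≡⟨ cong (λ y → sixteenth ⊛ (y ⊕ m2 ⊛ (T x j ⊕ p2 ⊛ x j))) T-expand ⟩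
  sixteenth ⊛ (T (T x) j ⊕ p2 ⊛ T x j ⊕ m2 ⊛ (T x j ⊕ p2 ⊛ x j))
    ≡⟨ collect (T (T x) j) (T x j) (x j) ⟩
  sixteenth ⊛ (T (T x) j ⊖ ι 4 ⊛ x j) ∎
  where
  open ≡-Reasoning
  open IsLinearForm (T-linear j)
  p2 m2 : ℚi
  p2 = ofℤ (+ 2)
  m2 = ofℤ (ℤ.- + 2)
  T-expand : T (T x +ᵥ p2 ·ᵥ x) j ≡ T (T x) j ⊕ p2 ⊛ T x j
  T-expand = trans (additive (T x) (p2 ·ᵥ x)) (cong (T (T x) j ⊕_) (homogeneous p2 x))
  collect : ∀ a b c → sixteenth ⊛ (a ⊕ ofℤ (+ 2) ⊛ b ⊕ ofℤ (ℤ.- + 2) ⊛ (b ⊕ ofℤ (+ 2) ⊛ c))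
                    ≡ sixteenth ⊛ (a ⊖ ι 4 ⊛ c)
  collect = solve-∀ ℚi-ring

Ladder : (n : ℕ) → ℚi → ℚi → Op n
Ladder n α β = (α ·ₒ Eop n) +ₒ (β ·ₒ Fop n)

IsLadder : (n : ℕ) → ℚi → ℚi → Op n → Set
IsLadder n α β T =
  ∀ k → T (v n k) ≈ᵥ (α ⊛ (ι n ⊖ ι k ⊕ 𝟙)) ·ᵥ vPrev n k +ᵥ (β ⊛ (ι k ⊕ 𝟙)) ·ᵥ v n (suc k)

Ladder-linear : ∀ n α β → IsLinear (Ladder n α β)
Ladder-linear n α β = +ₒ-linear (·ₒ-linear α Eop-linear) (·ₒ-linear β Fop-linear)

Ladder-isLadder : ∀ n α β → IsLadder n α β (Ladder n α β)
Ladder-isLadder n α β k j = cong₂ _⊕_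
  (trans (cong (α ⊛_) (E-v n k j)) (sym (⊛-assoc α _ _)))
  (trans (cong (β ⊛_) (F-v n k j)) (sym (⊛-assoc β _ _)))

E+F-isLadder : ∀ n → IsLadder n 𝟙 𝟙 (Eop n +ₒ Fop n)
E+F-isLadder n k j =
  trans (cong₂ _⊕_ (sym (⊛-identityˡ (Eop n (v n k) j))) (sym (⊛-identityˡ (Fop n (v n k) j))))
        (Ladder-isLadder n 𝟙 𝟙 k j)

♯B-v : ∀ n k → ♯B n (v n k) ≈ᵥ (sixteenth ⊛ (weight n k ⊛ weight n k ⊖ ι 4)) ·ᵥ v n k
♯B-v n k j = begin
  ♯B n (v n k) j
    ≡⟨ shiftedSquare-apply Hop-linear (v n k) j ⟩
  sixteenth ⊛ (Hop n (Hop n (v n k)) j ⊖ ι 4 ⊛ v n k j)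
    ≡⟨ cong (λ x → sixteenth ⊛ (x ⊖ ι 4 ⊛ v n k j)) H²-v ⟩
  sixteenth ⊛ (h ⊛ (h ⊛ v n k j) ⊖ ι 4 ⊛ v n k j)
    ≡⟨ collect (sixteenth) h (v n k j) ⟩
  (sixteenth ⊛ (h ⊛ h ⊖ ι 4)) ⊛ v n k j ∎
  where
  open ≡-Reasoning
  open IsLinearForm (Hop-linear j)
  h = weight n k
  H²-v : Hop n (Hop n (v n k)) j ≡ h ⊛ (h ⊛ v n k j)
  H²-v = trans (preserves-≈ (H-v n k)) (trans (homogeneous h (v n k)) (cong (h ⊛_) (H-v n k j)))
  collect : ∀ s h x → s ⊛ (h ⊛ (h ⊛ x) ⊖ ι 4 ⊛ x) ≡ (s ⊛ (h ⊛ h ⊖ ι 4)) ⊛ x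
  collect = solve-∀ ℚi-ring

ofℤ-weight : ∀ n i → ofℤ (+ n ℤ.- + (4 * i ℕ.+ 2)) ≡ weight n (suc (2 * i))
ofℤ-weight n i = begin
  ofℤ (+ n ℤ.- + (4 * i ℕ.+ 2))   ≡⟨ ofℤ-pos-sub n (4 * i ℕ.+ 2) ⟩
  ι n ⊖ ι (4 * i ℕ.+ 2)           ≡⟨ cong (λ m → ι n ⊖ ι m) (index i) ⟩
  ι n ⊖ ι (2 * suc (2 * i))       ≡⟨ cong (ι n ⊖_) (ι-homo-* 2 (suc (2 * i))) ⟩
  weight n (suc (2 * i))          ∎
  where
  open ≡-Reasoning
  index : ∀ i → 4 * i ℕ.+ 2 ≡ 2 * suc (2 * i)
  index = ℕ-Solver.solve-∀

b-closed : ∀ n i → b n i ≡ sixteenth ⊛ ((ι n ⊖ ι (2 * i)) ⊛ (ι n ⊖ ι (2 * i) ⊕ 𝟙))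
b-closed n i = begin
  q (d ℤ.* (d ℤ.+ + 1)) 16                     ≡⟨ q-split (d ℤ.* (d ℤ.+ + 1)) 15 ⟩
  ofℤ (d ℤ.* (d ℤ.+ + 1)) ⊛ sixteenth          ≡⟨ ⊛-comm (ofℤ (d ℤ.* (d ℤ.+ + 1))) sixteenth ⟩
  sixteenth ⊛ ofℤ (d ℤ.* (d ℤ.+ + 1))          ≡⟨ cong (sixteenth ⊛_) numerator ⟩
  sixteenth ⊛ ((ι n ⊖ ι (2 * i)) ⊛ (ι n ⊖ ι (2 * i) ⊕ 𝟙)) ∎
  where
  open ≡-Reasoning
  d = + n ℤ.- + (2 * i)
  numerator : ofℤ (d ℤ.* (d ℤ.+ + 1)) ≡ (ι n ⊖ ι (2 * i)) ⊛ (ι n ⊖ ι (2 * i) ⊕ 𝟙)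
  numerator = trans (ofℤ-homo-* d (d ℤ.+ + 1))
    (cong₂ _⊛_ (ofℤ-pos-sub n (2 * i))
               (trans (ofℤ-homo-+ d (+ 1)) (cong (_⊕ 𝟙) (ofℤ-pos-sub n (2 * i)))))

c-closed : ∀ n i → c n i ≡ sixteenth ⊛ ((ι (2 * i) ⊕ 𝟙 ⊕ 𝟙) ⊛ (ι (2 * i) ⊕ 𝟙 ⊕ 𝟙 ⊕ 𝟙))
c-closed n i = begin
  q (+ suc i ℤ.* + (2 * i ℕ.+ 3)) 8                     ≡⟨ q-split (+ suc i ℤ.* + (2 * i ℕ.+ 3)) 7 ⟩
  ofℤ (+ suc i ℤ.* + (2 * i ℕ.+ 3)) ⊛ q (+ 1) 8         ≡⟨ cong (_⊛ q (+ 1) 8) numerator ⟩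
  ((ι i ⊕ 𝟙) ⊛ (ι 2 ⊛ ι i ⊕ ι 3)) ⊛ q (+ 1) 8           ≡⟨ halve (ι i) ⟩
  sixteenth ⊛ ((ι 2 ⊛ ι i ⊕ 𝟙 ⊕ 𝟙) ⊛ (ι 2 ⊛ ι i ⊕ 𝟙 ⊕ 𝟙 ⊕ 𝟙))
    ≡⟨ cong (λ K → sixteenth ⊛ ((K ⊕ 𝟙 ⊕ 𝟙) ⊛ (K ⊕ 𝟙 ⊕ 𝟙 ⊕ 𝟙))) (ι-homo-* 2 i) ⟨
  sixteenth ⊛ ((ι (2 * i) ⊕ 𝟙 ⊕ 𝟙) ⊛ (ι (2 * i) ⊕ 𝟙 ⊕ 𝟙 ⊕ 𝟙)) ∎
  where
  open ≡-Reasoning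
  numerator : ofℤ (+ suc i ℤ.* + (2 * i ℕ.+ 3)) ≡ (ι i ⊕ 𝟙) ⊛ (ι 2 ⊛ ι i ⊕ ι 3)
  numerator = trans (ofℤ-homo-* (+ suc i) (+ (2 * i ℕ.+ 3))) (cong₂ _⊛_ (ofℤ-pos (suc i))
    (trans (ofℤ-pos (2 * i ℕ.+ 3)) (trans (ι-homo-+ (2 * i) 3) (cong (_⊕ ι 3) (ι-homo-* 2 i)))))
  halve : ∀ I → ((I ⊕ 𝟙) ⊛ (ι 2 ⊛ I ⊕ ι 3)) ⊛ q (+ 1) 8
              ≡ sixteenth ⊛ ((ι 2 ⊛ I ⊕ 𝟙 ⊕ 𝟙) ⊛ (ι 2 ⊛ I ⊕ 𝟙 ⊕ 𝟙 ⊕ 𝟙))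
  halve = solve-∀ ℚi-ring

θ*-closed : ∀ n i → θ* n i ≡ sixteenth ⊛ (weight n (suc (2 * i)) ⊛ weight n (suc (2 * i)) ⊖ ι 4)
θ*-closed n i = begin
  q (d ℤ.* d) 16 ⊖ q (+ 1) 4                ≡⟨ cong (_⊖ q (+ 1) 4) (q-split (d ℤ.* d) 15) ⟩
  ofℤ (d ℤ.* d) ⊛ sixteenth ⊖ q (+ 1) 4     ≡⟨ cong (λ x → x ⊛ sixteenth ⊖ q (+ 1) 4) numerator ⟩
  (h ⊛ h) ⊛ sixteenth ⊖ q (+ 1) 4           ≡⟨ rearrange h ⟩
  sixteenth ⊛ (h ⊛ h ⊖ ι 4)                 ∎
  where
  open ≡-Reasoning
  d = + n ℤ.- + (4 * i ℕ.+ 2)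
  h = weight n (suc (2 * i))
  numerator : ofℤ (d ℤ.* d) ≡ h ⊛ h
  numerator = trans (ofℤ-homo-* d d) (cong₂ _⊛_ (ofℤ-weight n i) (ofℤ-weight n i))
  rearrange : ∀ h → (h ⊛ h) ⊛ sixteenth ⊖ q (+ 1) 4 ≡ sixteenth ⊛ (h ⊛ h ⊖ ι 4)
  rearrange = solve-∀ ℚi-ring

a-closed : ∀ n i → a n i ≡ sixteenth ⊛
  ((ι n ⊖ ι (2 * i)) ⊛ (ι (2 * i) ⊕ 𝟙) ⊕ (ι (2 * i) ⊕ 𝟙 ⊕ 𝟙) ⊛ (ι n ⊖ ι (2 * i) ⊖ 𝟙) ⊖ ι 4)
a-closed n i = begin
  q (+ n ℤ.* + (n ℕ.+ 2) ℤ.- d ℤ.* d) 32 ⊖ q (+ 1) 4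
    ≡⟨ cong (_⊖ q (+ 1) 4) (q-split (+ n ℤ.* + (n ℕ.+ 2) ℤ.- d ℤ.* d) 31) ⟩
  ofℤ (+ n ℤ.* + (n ℕ.+ 2) ℤ.- d ℤ.* d) ⊛ q (+ 1) 32 ⊖ q (+ 1) 4
    ≡⟨ cong (λ x → x ⊛ q (+ 1) 32 ⊖ q (+ 1) 4) numerator ⟩
  (ι n ⊛ (ι n ⊕ ι 2) ⊖ weight n (suc (2 * i)) ⊛ weight n (suc (2 * i))) ⊛ q (+ 1) 32 ⊖ q (+ 1) 4
    ≡⟨ rearrange (ι n) (ι (2 * i)) ⟩
  sixteenth ⊛ ((ι n ⊖ ι (2 * i)) ⊛ (ι (2 * i) ⊕ 𝟙) ⊕ (ι (2 * i) ⊕ 𝟙 ⊕ 𝟙) ⊛ (ι n ⊖ ι (2 * i) ⊖ 𝟙) ⊖ ι 4) ∎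
  where
  open ≡-Reasoning
  d = + n ℤ.- + (4 * i ℕ.+ 2)
  numerator : ofℤ (+ n ℤ.* + (n ℕ.+ 2) ℤ.- d ℤ.* d)
            ≡ ι n ⊛ (ι n ⊕ ι 2) ⊖ weight n (suc (2 * i)) ⊛ weight n (suc (2 * i))
  numerator = trans (ofℤ-homo-sub (+ n ℤ.* + (n ℕ.+ 2)) (d ℤ.* d)) (cong₂ _⊖_
    (trans (ofℤ-homo-* (+ n) (+ (n ℕ.+ 2)))
           (cong₂ _⊛_ (ofℤ-pos n) (trans (ofℤ-pos (n ℕ.+ 2)) (ι-homo-+ n 2))))
    (trans (ofℤ-homo-* d d) (cong₂ _⊛_ (ofℤ-weight n i) (ofℤ-weight n i))))
  rearrange : ∀ N K →
      (N ⊛ (N ⊕ ι 2) ⊖ (N ⊖ ι 2 ⊛ (K ⊕ 𝟙)) ⊛ (N ⊖ ι 2 ⊛ (K ⊕ 𝟙))) ⊛ q (+ 1) 32 ⊖ q (+ 1) 4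
    ≡ sixteenth ⊛ ((N ⊖ K) ⊛ (K ⊕ 𝟙) ⊕ (K ⊕ 𝟙 ⊕ 𝟙) ⊛ (N ⊖ K ⊖ 𝟙) ⊖ ι 4)
  rearrange = solve-∀ ℚi-ring

vPrev-double : ∀ n i → vPrev n (2 * i) ≡ uPrev n i
vPrev-double n zero    = refl
vPrev-double n (suc i) = cong (vPrev n) (ℕP.*-suc 2 i)

v-odd-suc : ∀ n i → v n (3 ℕ.+ 2 * i) ≡ u n (suc i)
v-odd-suc n i = cong (λ m → v n (suc m)) (sym (ℕP.*-suc 2 i))

module _ {n : ℕ} (α β : ℚi) (T : Op n) (T-linear : IsLinear T) (T-ladder : IsLadder n α β T) where

  ladder-square-v : ∀ k → T (T (v n (suc k))) ≈ᵥ
       (α ⊛ α ⊛ ((ι n ⊖ ι k) ⊛ (ι n ⊖ ι k ⊕ 𝟙))) ·ᵥ vPrev n k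
    +ᵥ (α ⊛ β ⊛ ((ι n ⊖ ι k) ⊛ (ι k ⊕ 𝟙) ⊕ (ι k ⊕ 𝟙 ⊕ 𝟙) ⊛ (ι n ⊖ ι k ⊖ 𝟙))) ·ᵥ v n (suc k)
    +ᵥ (β ⊛ β ⊛ ((ι k ⊕ 𝟙 ⊕ 𝟙) ⊛ (ι k ⊕ 𝟙 ⊕ 𝟙 ⊕ 𝟙))) ·ᵥ v n (3 ℕ.+ k)
  ladder-square-v k j = begin
    T (T (v n (suc k))) j
      ≡⟨ preserves-≈ (T-ladder (suc k)) ⟩
    T (d₁ ·ᵥ v n k +ᵥ u₁ ·ᵥ v n (2 ℕ.+ k)) j
      ≡⟨ combination d₁ u₁ (v n k) (v n (2 ℕ.+ k)) ⟩
    d₁ ⊛ T (v n k) j ⊕ u₁ ⊛ T (v n (2 ℕ.+ k)) j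
      ≡⟨ cong₂ (λ x y → d₁ ⊛ x ⊕ u₁ ⊛ y) (T-ladder k j) (T-ladder (2 ℕ.+ k) j) ⟩
    d₁ ⊛ ((α ⊛ (ι n ⊖ ι k ⊕ 𝟙)) ⊛ vPrev n k j ⊕ (β ⊛ (ι k ⊕ 𝟙)) ⊛ v n (suc k) j)
      ⊕ u₁ ⊛ ((α ⊛ (ι n ⊖ ι (2 ℕ.+ k) ⊕ 𝟙)) ⊛ v n (suc k) j ⊕ (β ⊛ (ι (2 ℕ.+ k) ⊕ 𝟙)) ⊛ v n (3 ℕ.+ k) j)
      ≡⟨ collect α β (ι n) (ι k) (vPrev n k j) (v n (suc k) j) (v n (3 ℕ.+ k) j) ⟩
    (α ⊛ α ⊛ ((ι n ⊖ ι k) ⊛ (ι n ⊖ ι k ⊕ 𝟙))) ⊛ vPrev n k j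
      ⊕ (α ⊛ β ⊛ ((ι n ⊖ ι k) ⊛ (ι k ⊕ 𝟙) ⊕ (ι k ⊕ 𝟙 ⊕ 𝟙) ⊛ (ι n ⊖ ι k ⊖ 𝟙))) ⊛ v n (suc k) j
      ⊕ (β ⊛ β ⊛ ((ι k ⊕ 𝟙 ⊕ 𝟙) ⊛ (ι k ⊕ 𝟙 ⊕ 𝟙 ⊕ 𝟙))) ⊛ v n (3 ℕ.+ k) j ∎
    where
    open ≡-Reasoning
    open IsLinearForm (T-linear j)
    d₁ u₁ : ℚi
    d₁ = α ⊛ (ι n ⊖ ι (suc k) ⊕ 𝟙)
    u₁ = β ⊛ (ι (suc k) ⊕ 𝟙)
    collect : ∀ α β N K P V W →
        α ⊛ (N ⊖ (K ⊕ 𝟙) ⊕ 𝟙) ⊛ ((α ⊛ (N ⊖ K ⊕ 𝟙)) ⊛ P ⊕ (β ⊛ (K ⊕ 𝟙)) ⊛ V)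
          ⊕ β ⊛ (K ⊕ 𝟙 ⊕ 𝟙) ⊛ ((α ⊛ (N ⊖ (K ⊕ 𝟙 ⊕ 𝟙) ⊕ 𝟙)) ⊛ V ⊕ (β ⊛ (K ⊕ 𝟙 ⊕ 𝟙 ⊕ 𝟙)) ⊛ W)
      ≡ (α ⊛ α ⊛ ((N ⊖ K) ⊛ (N ⊖ K ⊕ 𝟙))) ⊛ P
          ⊕ (α ⊛ β ⊛ ((N ⊖ K) ⊛ (K ⊕ 𝟙) ⊕ (K ⊕ 𝟙 ⊕ 𝟙) ⊛ (N ⊖ K ⊖ 𝟙))) ⊛ V
          ⊕ (β ⊛ β ⊛ ((K ⊕ 𝟙 ⊕ 𝟙) ⊛ (K ⊕ 𝟙 ⊕ 𝟙 ⊕ 𝟙))) ⊛ W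
    collect = solve-∀ ℚi-ring

  shiftedSquare-u : α ⊛ β ≡ 𝟙 → ∀ i → shiftedSquare T (u n i) ≈ᵥ
    (α ⊛ α ⊛ b n i) ·ᵥ uPrev n i +ᵥ a n i ·ᵥ u n i +ᵥ (β ⊛ β ⊛ c n i) ·ᵥ u n (suc i)
  shiftedSquare-u αβ≡1 i j = begin
    shiftedSquare T (u n i) j
      ≡⟨ shiftedSquare-apply T-linear (u n i) j ⟩
    sixteenth ⊛ (T (T (u n i)) j ⊖ ι 4 ⊛ U)
      ≡⟨ cong (λ x → sixteenth ⊛ (x ⊖ ι 4 ⊛ U)) (ladder-square-v (2 * i) j) ⟩
    sixteenth ⊛ ((α ⊛ α ⊛ B) ⊛ vPrev n (2 * i) j ⊕ (α ⊛ β ⊛ M) ⊛ U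
                   ⊕ (β ⊛ β ⊛ C) ⊛ v n (3 ℕ.+ 2 * i) j ⊖ ι 4 ⊛ U)
      ≡⟨ cong₂ (λ p w → sixteenth ⊛ ((α ⊛ α ⊛ B) ⊛ p ⊕ (α ⊛ β ⊛ M) ⊛ U ⊕ (β ⊛ β ⊛ C) ⊛ w ⊖ ι 4 ⊛ U))
               (cong (λ x → x j) (vPrev-double n i)) (cong (λ x → x j) (v-odd-suc n i)) ⟩
    sixteenth ⊛ ((α ⊛ α ⊛ B) ⊛ P ⊕ (α ⊛ β ⊛ M) ⊛ U ⊕ (β ⊛ β ⊛ C) ⊛ W ⊖ ι 4 ⊛ U)
      ≡⟨ distribute α β B M C P U W ⟩
    (α ⊛ α ⊛ (sixteenth ⊛ B)) ⊛ P ⊕ (sixteenth ⊛ ((α ⊛ β) ⊛ M ⊖ ι 4)) ⊛ U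
      ⊕ (β ⊛ β ⊛ (sixteenth ⊛ C)) ⊛ W
      ≡⟨ cong₂ _⊕_ (cong₂ _⊕_ (cong (λ x → (α ⊛ α ⊛ x) ⊛ P) (sym (b-closed n i)))
                              (cong (_⊛ U) diagonal))
                   (cong (λ x → (β ⊛ β ⊛ x) ⊛ W) (sym (c-closed n i))) ⟩
    (α ⊛ α ⊛ b n i) ⊛ P ⊕ a n i ⊛ U ⊕ (β ⊛ β ⊛ c n i) ⊛ W ∎
    where
    open ≡-Reasoning
    K = ι (2 * i)
    B = (ι n ⊖ K) ⊛ (ι n ⊖ K ⊕ 𝟙)
    M = (ι n ⊖ K) ⊛ (K ⊕ 𝟙) ⊕ (K ⊕ 𝟙 ⊕ 𝟙) ⊛ (ι n ⊖ K ⊖ 𝟙)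
    C = (K ⊕ 𝟙 ⊕ 𝟙) ⊛ (K ⊕ 𝟙 ⊕ 𝟙 ⊕ 𝟙)
    P = uPrev n i j
    U = u n i j
    W = u n (suc i) j
    diagonal : sixteenth ⊛ ((α ⊛ β) ⊛ M ⊖ ι 4) ≡ a n i
    diagonal = trans (cong (λ x → sixteenth ⊛ (x ⊖ ι 4)) (trans (cong (_⊛ M) αβ≡1) (⊛-identityˡ M)))
                     (sym (a-closed n i))
    distribute : ∀ α β B M C P U W →
        sixteenth ⊛ ((α ⊛ α ⊛ B) ⊛ P ⊕ (α ⊛ β ⊛ M) ⊛ U ⊕ (β ⊛ β ⊛ C) ⊛ W ⊖ ι 4 ⊛ U)
      ≡ (α ⊛ α ⊛ (sixteenth ⊛ B)) ⊛ P ⊕ (sixteenth ⊛ ((α ⊛ β) ⊛ M ⊖ ι 4)) ⊛ U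
          ⊕ (β ⊛ β ⊛ (sixteenth ⊛ C)) ⊛ W
    distribute = solve-∀ ℚi-ring

proposition7p5 : (n : ℕ) → 1 ≤ n → (i : ℕ) → suc (2 * i) ≤ n →
  (♯A n (u n i) ≈ᵥ ((b n i ·ᵥ uPrev n i) +ᵥ (a n i ·ᵥ u n i) +ᵥ (c n i ·ᵥ u n (suc i))))
  × (♯B n (u n i) ≈ᵥ (θ* n i ·ᵥ u n i))
  × (♯C n (u n i) ≈ᵥ (((⊝ b n i) ·ᵥ uPrev n i) +ᵥ (a n i ·ᵥ u n i) +ᵥ ((⊝ c n i) ·ᵥ u n (suc i))))
proposition7p5 n _ i _ = A-action , B-action , C-action
  where
  A-action : ♯A n (u n i) ≈ᵥ ((b n i ·ᵥ uPrev n i) +ᵥ (a n i ·ᵥ u n i) +ᵥ (c n i ·ᵥ u n (suc i)))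
  A-action j = trans
    (shiftedSquare-u 𝟙 𝟙 (Eop n +ₒ Fop n) (+ₒ-linear Eop-linear Fop-linear) (E+F-isLadder n)
                     refl i j)
    (cong₂ (λ x y → x ⊛ uPrev n i j ⊕ a n i ⊛ u n i j ⊕ y ⊛ u n (suc i) j)
           (⊛-identityˡ (b n i)) (⊛-identityˡ (c n i)))
  B-action : ♯B n (u n i) ≈ᵥ (θ* n i ·ᵥ u n i)
  B-action j = trans (♯B-v n (suc (2 * i)) j) (cong (_⊛ u n i j) (sym (θ*-closed n i)))
  C-action : ♯C n (u n i) ≈ᵥ (((⊝ b n i) ·ᵥ uPrev n i) +ᵥ (a n i ·ᵥ u n i) +ᵥ ((⊝ c n i) ·ᵥ u n (suc i)))
  -- 𝐢 ⊛ ⊝ 𝐢 computes to 𝟙, and 𝐢 ⊛ 𝐢 and ⊝ 𝐢 ⊛ ⊝ 𝐢 compute to ⊝ 𝟙.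
  C-action j = trans
    (shiftedSquare-u 𝐢 (⊝ 𝐢) (Ladder n 𝐢 (⊝ 𝐢)) (Ladder-linear n 𝐢 (⊝ 𝐢)) (Ladder-isLadder n 𝐢 (⊝ 𝐢))
                     refl i j)
    (cong₂ (λ x y → x ⊛ uPrev n i j ⊕ a n i ⊛ u n i j ⊕ y ⊛ u n (suc i) j)
           (-1*x≈-x (b n i)) (-1*x≈-x (c n i)))
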